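{- For any finite simple graphs $G$ and $H$, $$\max\{P_2(G)\gamma(H),\ \gamma(G)P_2(H)\}\le \gamma_R(G\boxtimes H)\le 2\gamma(G)\gamma(H).$$
   Context: $\gamma(X)$ denotes the domination number of a graph $X$ (minimum size of a set $D$ such that every vertex outside $D$ has a neighbor in $D$). A Roman dominating function on $X$ is a map $f:V(X)\to\{0,1,2\}$ such that every vertex $v$ with $f(v)=0$ has a neighbor $u$ with $f(u)=2$; $\gamma_R(X)$ is the minimum of $\sum_v f(v)$ over such $f$. A 2-packing of $X$ is a set of vertices pairwise at distance more than two; $P_2(X)$ is the maximum size of a 2-packing. The strong product $G\boxtimes H$ has vertex set $V(G)\times V(H)$, with distinct $(g,h),(g',h')$ adjacent iff ($g=g'$ and $h\sim h'$) or ($g\sim g'$ and $h=h'$) or ($g\sim g'$ and $h\sim h'$). -}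

module Defs where

open import Data.Nat using (ℕ; _+_; _*_; _≤_; _⊔_)
open import Data.Fin using (Fin; remQuot; toℕ; zero; suc; _≟_)
open import Data.Fin.Subset using (Subset; _∈_; _∉_; ∣_∣)
open import Data.Bool using (Bool; true; false; _∧_; _∨_)
open import Data.Bool.Properties using (∧-comm; ∨-comm)
open import Relation.Nullary using (¬_)
open import Relation.Nullary.Decidable using (isYes)
open import Data.Product using (Σ; ∃; _×_; _,_; proj₁; proj₂)
open import Data.Sum using (_⊎_)
open import Data.Empty using (⊥; ⊥-elim)
import Relation.Nullary
open import Relation.Binary.PropositionalEquality using (_≡_; _≢_; refl; sym; cong; cong₂; trans)
open import Data.Vec.Functional using (foldr)

record Graph : Set where
  field
    n     : ℕ
    adj   : Fin n → Fin n → Bool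
    adj-sym : ∀ u v → adj u v ≡ adj v u
    adj-irrefl : ∀ v → adj v v ≡ false

open Graph public

Adj : (G : Graph) → Fin (n G) → Fin (n G) → Set
Adj G u v = adj G u v ≡ true

IsDominating : (G : Graph) → Subset (n G) → Set
IsDominating G D = ∀ v → v ∉ D → ∃ λ u → u ∈ D × Adj G u v

IsDominationNumber : Graph → ℕ → Set
IsDominationNumber G k =
  (∃ λ D → IsDominating G D × ∣ D ∣ ≡ k) ×
  (∀ D → IsDominating G D → k ≤ ∣ D ∣)

WithinTwo : (G : Graph) → Fin (n G) → Fin (n G) → Set
WithinTwo G u v = Adj G u v ⊎ (∃ λ w → Adj G u w × Adj G w v)

Is2Packing : (G : Graph) → Subset (n G) → Set
Is2Packing G S = ∀ u v → u ∈ S → v ∈ S → u ≢ v → ¬ WithinTwo G u v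

IsPackingNumber : Graph → ℕ → Set
IsPackingNumber G k =
  (∃ λ S → Is2Packing G S × ∣ S ∣ ≡ k) ×
  (∀ S → Is2Packing G S → ∣ S ∣ ≤ k)

IsRomanDominating : (G : Graph) → (Fin (n G) → Fin 3) → Set
IsRomanDominating G f =
  ∀ v → f v ≡ zero → ∃ λ u → Adj G u v × f u ≡ suc (suc zero)

weight : ∀ {m} → (Fin m → Fin 3) → ℕ
weight f = foldr _+_ 0 (λ i → toℕ (f i))

IsRomanDominationNumber : Graph → ℕ → Set
IsRomanDominationNumber G k =
  (∃ λ f → IsRomanDominating G f × weight f ≡ k) ×
  (∀ f → IsRomanDominating G f → k ≤ weight f)

_≡ᵇ_ : ∀ {k} → Fin k → Fin k → Bool
a ≡ᵇ b = isYes (a ≟ b)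

≡ᵇ-sym : ∀ {k} (a b : Fin k) → (a ≡ᵇ b) ≡ (b ≡ᵇ a)
≡ᵇ-sym a b with a ≟ b | b ≟ a
... | Relation.Nullary.yes _ | Relation.Nullary.yes _ = refl
... | Relation.Nullary.no _  | Relation.Nullary.no _  = refl
... | Relation.Nullary.yes p | Relation.Nullary.no q  = ⊥-elim (q (sym p))
... | Relation.Nullary.no p  | Relation.Nullary.yes q = ⊥-elim (p (sym q))

strongAdj' : (G H : Graph) → Fin (n G) × Fin (n H) → Fin (n G) × Fin (n H) → Bool
strongAdj' G H (g , h) (g' , h') =
  ((g ≡ᵇ g') ∧ adj H h h') ∨ ((adj G g g' ∧ (h ≡ᵇ h')) ∨ (adj G g g' ∧ adj H h h'))

strongAdj'-sym : ∀ G H x y → strongAdj' G H x y ≡ strongAdj' G H y x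
strongAdj'-sym G H (g , h) (g' , h')
  rewrite ≡ᵇ-sym g g' | ≡ᵇ-sym h h' | Graph.adj-sym G g g' | Graph.adj-sym H h h' = refl

≡ᵇ-refl : ∀ {k} (a : Fin k) → (a ≡ᵇ a) ≡ true
≡ᵇ-refl a with a ≟ a
... | Relation.Nullary.yes _ = refl
... | Relation.Nullary.no p = ⊥-elim (p refl)

strongAdj'-irrefl : ∀ G H x → strongAdj' G H x x ≡ false
strongAdj'-irrefl G H (g , h)
  rewrite Graph.adj-irrefl G g | Graph.adj-irrefl H h | ≡ᵇ-refl g = refl

-- strong product G ⊠ H; vertex (g , h) is encoded as combine g h, i.e.
-- the vertex x : Fin (n G * n H) stands for remQuot (n H) x.
_⊠_ : Graph → Graph → Graph
G ⊠ H = record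
  { n = n G * n H
  ; adj = λ x y → strongAdj' G H (remQuot (n H) x) (remQuot (n H) y)
  ; adj-sym = λ x y → strongAdj'-sym G H (remQuot (n H) x) (remQuot (n H) y)
  ; adj-irrefl = λ x → strongAdj'-irrefl G H (remQuot (n H) x)
  }

-- Upper bound: for minimum dominating sets D_G, D_H, the function that is 2 on D_G × D_H and 0
-- elsewhere is Roman dominating, because the closed neighbourhoods of G ⊠ H are the products
-- N[g] × N[h].  Lower bound: the support of a Roman dominating function f dominates G ⊠ H.  For
-- each vertex s of a 2-packing S of G, the H-coordinates of the support points lying in
-- N[s] × V(H) form a dominating set of H, so γ(H) is at most the number of support points in
-- N[s] × V(H).  The neighbourhoods N[s], s ∈ S, are pairwise disjoint, so summing over S gives
-- |S| γ(H) ≤ |supp f| ≤ weight f; exchanging G and H gives the other bound.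

module Submission where

open import Defs
open import Data.Nat using (ℕ; zero; suc; _+_; _*_; _≤_; _⊔_; z≤n; s≤s)
open import Data.Nat.Properties
  using ( +-*-semiring; +-assoc; +-identityʳ; *-comm; *-assoc; *-identityˡ; ≤-reflexive; ≤-trans
        ; +-mono-≤; *-monoˡ-≤; *-monoʳ-≤; m≤m+n; m≤n+m; ⊔-lub; module ≤-Reasoning)
open import Data.Fin as Fin using (Fin; combine; remQuot; toℕ; _↑ˡ_; _↑ʳ_; _≟_)
open import Data.Fin.Properties using (remQuot-combine; combine-remQuot; any?; suc-injective; 0≢1+n)
open import Data.Fin.Subset using (Subset; _∈_; ∣_∣)
open import Data.Fin.Subset.Properties using (_∈?_)
open import Data.Vec using ([]; _∷_; lookup; tabulate)
open import Data.Vec.Properties using (lookup⇒[]=; []=⇒lookup; lookup∘tabulate)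
open import Data.Bool using (Bool; true; false; _∧_; _∨_)
open import Data.Bool.Properties using (∨-zeroʳ; ∧-conicalˡ; ∧-conicalʳ) renaming (_≟_ to _≟ᵇ_)
open import Data.Product using (∃; ∃₂; _×_; _,_; proj₁; proj₂; uncurry)
open import Data.Sum using (_⊎_; inj₁; inj₂)
open import Function using (_∘_; flip)
open import Relation.Nullary using (yes; no; does; contradiction)
open import Relation.Nullary.Decidable using (dec-true)
open import Relation.Binary.PropositionalEquality
  using (_≡_; _≢_; refl; sym; trans; cong; cong₂; subst; subst₂; module ≡-Reasoning)
open import Algebra.Properties.Semiring.Sum +-*-semiring
  using (sum; sum-syntax; ∑-comm; sum-cong-≗; sum-replicate-zero; *-distribˡ-sum; *-distribʳ-sum)

𝟙 : Bool → ℕ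
𝟙 true  = 1
𝟙 false = 0

𝟙-∧ : ∀ x y → 𝟙 (x ∧ y) ≡ 𝟙 x * 𝟙 y
𝟙-∧ true  y = sym (+-identityʳ (𝟙 y))
𝟙-∧ false y = refl

∑-mono-≤ : ∀ {m} {f g : Fin m → ℕ} → (∀ i → f i ≤ g i) → sum f ≤ sum g
∑-mono-≤ {zero}  f≤g = z≤n
∑-mono-≤ {suc m} f≤g = +-mono-≤ (f≤g Fin.zero) (∑-mono-≤ (f≤g ∘ Fin.suc))

≤-∑ : ∀ {m} (f : Fin m → ℕ) i → f i ≤ sum f
≤-∑ f Fin.zero    = m≤m+n _ _
≤-∑ f (Fin.suc i) = ≤-trans (≤-∑ (f ∘ Fin.suc) i) (m≤n+m _ _)

∑𝟙≤1 : ∀ {m} (b : Fin m → Bool) → (∀ i j → b i ≡ true → b j ≡ true → i ≡ j) →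
       sum (𝟙 ∘ b) ≤ 1
∑𝟙≤1 {zero}  b unique = z≤n
∑𝟙≤1 {suc m} b unique with b Fin.zero in b₀
... | false = ∑𝟙≤1 (b ∘ Fin.suc) (λ i j p q → suc-injective (unique _ _ p q))
... | true  = s≤s (≤-trans (∑-mono-≤ others-absent) (≤-reflexive (sum-replicate-zero m)))
  where
  others-absent : ∀ i → 𝟙 (b (Fin.suc i)) ≤ 0
  others-absent i with b (Fin.suc i) in bᵢ
  ... | false = z≤n
  ... | true  with () ← unique _ _ b₀ bᵢ

anyᵇ : ∀ {m} → (Fin m → Bool) → Bool
anyᵇ b = does (any? λ i → b i ≟ᵇ true)

anyᵇ-intro : ∀ {m} (b : Fin m → Bool) i → b i ≡ true → anyᵇ b ≡ true
anyᵇ-intro b i bᵢ = dec-true (any? λ i → b i ≟ᵇ true) (i , bᵢ)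

𝟙-anyᵇ≤∑𝟙 : ∀ {m} (b : Fin m → Bool) → 𝟙 (anyᵇ b) ≤ sum (𝟙 ∘ b)
𝟙-anyᵇ≤∑𝟙 b with any? (λ i → b i ≟ᵇ true)
... | yes (i , bᵢ) = ≤-trans (≤-reflexive (cong 𝟙 (sym bᵢ))) (≤-∑ (𝟙 ∘ b) i)
... | no  _        = z≤n

∑-product : ∀ {m k} (a : Fin m → ℕ) (b : Fin k → ℕ) →
            ∑[ i < m ] ∑[ j < k ] (a i * b j) ≡ sum a * sum b
∑-product a b = begin
  ∑[ i < _ ] ∑[ j < _ ] (a i * b j)  ≡⟨ sum-cong-≗ (λ i → *-distribˡ-sum (a i) b) ⟨
  ∑[ i < _ ] (a i * sum b)           ≡⟨ *-distribʳ-sum (sum b) a ⟨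
  sum a * sum b                      ∎
  where open ≡-Reasoning

∑-disjoint-≤ : ∀ {m k} (a : Fin m → Fin k → Bool) (w : Fin k → ℕ) →
               (∀ j i i' → a i j ≡ true → a i' j ≡ true → i ≡ i') →
               ∑[ i < m ] ∑[ j < k ] (𝟙 (a i j) * w j) ≤ sum w
∑-disjoint-≤ {m} {k} a w disjoint = begin
  ∑[ i < m ] ∑[ j < k ] (𝟙 (a i j) * w j)
    ≡⟨ ∑-comm (λ i j → 𝟙 (a i j) * w j) ⟩
  ∑[ j < k ] ∑[ i < m ] (𝟙 (a i j) * w j)
    ≡⟨ sum-cong-≗ (λ j → *-distribʳ-sum (w j) (λ i → 𝟙 (a i j))) ⟨
  ∑[ j < k ] ((∑[ i < m ] 𝟙 (a i j)) * w j)
    ≤⟨ ∑-mono-≤ (λ j → *-monoˡ-≤ (w j) (∑𝟙≤1 _ (disjoint j))) ⟩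
  ∑[ j < k ] (1 * w j)
    ≡⟨ sum-cong-≗ (λ j → *-identityˡ (w j)) ⟩
  sum w
    ∎
  where open ≤-Reasoning

∑-↑ : ∀ m k (f : Fin (m + k) → ℕ) → sum f ≡ sum (f ∘ (_↑ˡ k)) + sum (f ∘ (m ↑ʳ_))
∑-↑ zero    k f = refl
∑-↑ (suc m) k f =
  trans (cong (f Fin.zero +_) (∑-↑ m k (f ∘ Fin.suc))) (sym (+-assoc (f Fin.zero) _ _))

∑-combine : ∀ m k (f : Fin (m * k) → ℕ) → sum f ≡ ∑[ i < m ] ∑[ j < k ] f (combine i j)
∑-combine zero    k f = refl
∑-combine (suc m) k f =
  trans (∑-↑ k (m * k) f) (cong (sum (f ∘ (_↑ˡ m * k)) +_) (∑-combine m k (f ∘ (k ↑ʳ_))))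

∣p∣≡∑𝟙 : ∀ {m} (p : Subset m) → ∣ p ∣ ≡ sum (𝟙 ∘ lookup p)
∣p∣≡∑𝟙 []          = refl
∣p∣≡∑𝟙 (true ∷ p)  = cong suc (∣p∣≡∑𝟙 p)
∣p∣≡∑𝟙 (false ∷ p) = ∣p∣≡∑𝟙 p

closedAdj : (G : Graph) → Fin (n G) → Fin (n G) → Bool
closedAdj G u v = (u ≡ᵇ v) ∨ adj G u v

closedAdj-refl : ∀ G v → closedAdj G v v ≡ true
closedAdj-refl G v rewrite ≡ᵇ-refl v = refl

Adj⇒closedAdj : ∀ G {u v} → Adj G u v → closedAdj G u v ≡ true
Adj⇒closedAdj G {u} {v} uv rewrite uv = ∨-zeroʳ (u ≡ᵇ v)

closedAdj⇒≡⊎Adj : ∀ G {u v} → closedAdj G u v ≡ true → u ≡ v ⊎ Adj G u v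
closedAdj⇒≡⊎Adj G {u} {v} uv with u ≟ v
... | yes u≡v = inj₁ u≡v
... | no  _   = inj₂ uv

IsClosedDominating : (G : Graph) → Subset (n G) → Set
IsClosedDominating G D = ∀ v → ∃ λ u → u ∈ D × closedAdj G u v ≡ true

IsDominating⇒IsClosedDominating : ∀ G D → IsDominating G D → IsClosedDominating G D
IsDominating⇒IsClosedDominating G D dom v with v ∈? D
... | yes v∈D = v , v∈D , closedAdj-refl G v
... | no  v∉D with dom v v∉D
...   | u , u∈D , uv = u , u∈D , Adj⇒closedAdj G uv

IsClosedDominating⇒IsDominating : ∀ G D → IsClosedDominating G D → IsDominating G D
IsClosedDominating⇒IsDominating G D dom v v∉D with dom v
... | u , u∈D , uv with closedAdj⇒≡⊎Adj G uv
...   | inj₁ refl = contradiction u∈D v∉D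
...   | inj₂ adj  = u , u∈D , adj

commonClosedNeighbour⇒WithinTwo : ∀ G {w s s'} → closedAdj G w s ≡ true →
                                  closedAdj G w s' ≡ true → s ≢ s' → WithinTwo G s s'
commonClosedNeighbour⇒WithinTwo G {w} {s} ws ws' s≢s'
  with closedAdj⇒≡⊎Adj G ws | closedAdj⇒≡⊎Adj G ws'
... | inj₁ refl | inj₁ refl = contradiction refl s≢s'
... | inj₁ refl | inj₂ ss'  = inj₁ ss'
... | inj₂ ws″  | inj₁ refl = inj₁ (trans (adj-sym G s w) ws″)
... | inj₂ ws″  | inj₂ ws‴  = inj₂ (w , trans (adj-sym G s w) ws″ , ws‴)

Is2Packing⇒closedNeighbourhoodsDisjoint :
  ∀ G {S} → Is2Packing G S → ∀ w s s' → s ∈ S → s' ∈ S →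
  closedAdj G w s ≡ true → closedAdj G w s' ≡ true → s ≡ s'
Is2Packing⇒closedNeighbourhoodsDisjoint G packing w s s' s∈S s'∈S ws ws' with s ≟ s'
... | yes s≡s' = s≡s'
... | no  s≢s' = contradiction (commonClosedNeighbour⇒WithinTwo G ws ws' s≢s')
                               (packing s s' s∈S s'∈S s≢s')

module _ (G H : Graph) where

  strongAdj'⇒closedAdj : ∀ {g' h' g h} → strongAdj' G H (g' , h') (g , h) ≡ true →
                         closedAdj G g' g ≡ true × closedAdj H h' h ≡ true
  strongAdj'⇒closedAdj {g'} {h'} {g} {h} = split (g' ≡ᵇ g) (adj H h' h) (adj G g' g) (h' ≡ᵇ h)
    where
    split : ∀ e a a' e' → (e ∧ a) ∨ ((a' ∧ e') ∨ (a' ∧ a)) ≡ true →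
            (e ∨ a') ≡ true × (e' ∨ a) ≡ true
    split true  true  _     _     _ = refl , ∨-zeroʳ _
    split _     _     true  true  _ = ∨-zeroʳ _ , refl
    split _     true  true  _     _ = ∨-zeroʳ _ , ∨-zeroʳ _
    split true  false false _     ()
    split false _     false _     ()
    split true  false true  false ()
    split false false true  false ()

  closedAdj⇒strongAdj' : ∀ {g' h' g h} → closedAdj G g' g ≡ true → closedAdj H h' h ≡ true →
                         (g' , h') ≢ (g , h) → strongAdj' G H (g' , h') (g , h) ≡ true
  closedAdj⇒strongAdj' {g'} {h'} {g} {h} g'g h'h distinct
    with closedAdj⇒≡⊎Adj G g'g | closedAdj⇒≡⊎Adj H h'h
  ... | inj₁ refl | inj₁ refl = contradiction refl distinct
  ... | inj₁ refl | inj₂ hh rewrite ≡ᵇ-refl g' | hh = refl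
  ... | inj₂ gg   | inj₁ refl rewrite gg | ≡ᵇ-refl h' = ∨-zeroʳ _
  ... | inj₂ gg   | inj₂ hh rewrite gg | hh | ∨-zeroʳ (h' ≡ᵇ h) = ∨-zeroʳ _

lift⊠ : ∀ {A : Set} G H → (Fin (n G) → Fin (n H) → A) → Fin (n (G ⊠ H)) → A
lift⊠ G H F x = uncurry F (remQuot {n G} (n H) x)

lift⊠-combine : ∀ {A : Set} G H (F : Fin (n G) → Fin (n H) → A) g h →
                lift⊠ G H F (combine g h) ≡ F g h
lift⊠-combine G H F g h = cong (uncurry F) (remQuot-combine g h)

-- D ⊆ V(G) × V(H) dominates G ⊠ H, whose closed neighbourhoods are the products N[g] × N[h].
IsProductDominating : (G H : Graph) → (Fin (n G) → Fin (n H) → Bool) → Set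
IsProductDominating G H D = ∀ g h → ∃₂ λ g' h' →
  D g' h' ≡ true × closedAdj G g' g ≡ true × closedAdj H h' h ≡ true

IsProductDominating-flip : ∀ {G H D} → IsProductDominating G H D → IsProductDominating H G (flip D)
IsProductDominating-flip D-dominating h g =
  let g' , h' , g'h'∈D , g'g , h'h = D-dominating g h in h' , g' , g'h'∈D , h'h , g'g

module _ (G H : Graph) (D : Fin (n G) → Fin (n H) → Bool)
         (D-dominating : IsProductDominating G H D) where

  seenFrom : Fin (n G) → Fin (n H) → Bool
  seenFrom s h = anyᵇ λ g → closedAdj G g s ∧ D g h

  shadow : Fin (n G) → Subset (n H)
  shadow s = tabulate (seenFrom s)

  ∈shadow : ∀ {s g h} → closedAdj G g s ≡ true → D g h ≡ true → h ∈ shadow s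
  ∈shadow {s} {g} {h} gs gh = lookup⇒[]= h (shadow s)
    (trans (lookup∘tabulate (seenFrom s) h) (anyᵇ-intro _ g (cong₂ _∧_ gs gh)))

  shadow-dominating : ∀ s → IsDominating H (shadow s)
  shadow-dominating s = IsClosedDominating⇒IsDominating H (shadow s) λ h →
    let g' , h' , g'h'∈D , g's , h'h = D-dominating s h in h' , ∈shadow g's g'h'∈D , h'h

  rowSize : Fin (n G) → ℕ
  rowSize g = ∑[ h < n H ] 𝟙 (D g h)

  ∣shadow∣≤ : ∀ s → ∣ shadow s ∣ ≤ ∑[ g < n G ] (𝟙 (closedAdj G g s) * rowSize g)
  ∣shadow∣≤ s = begin
    ∣ shadow s ∣
      ≡⟨ ∣p∣≡∑𝟙 (shadow s) ⟩
    ∑[ h < n H ] 𝟙 (lookup (shadow s) h)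
      ≡⟨ sum-cong-≗ (cong 𝟙 ∘ lookup∘tabulate (seenFrom s)) ⟩
    ∑[ h < n H ] 𝟙 (seenFrom s h)
      ≤⟨ ∑-mono-≤ (λ h → 𝟙-anyᵇ≤∑𝟙 (λ g → closedAdj G g s ∧ D g h)) ⟩
    ∑[ h < n H ] ∑[ g < n G ] 𝟙 (closedAdj G g s ∧ D g h)
      ≡⟨ ∑-comm (λ g h → 𝟙 (closedAdj G g s ∧ D g h)) ⟨
    ∑[ g < n G ] ∑[ h < n H ] 𝟙 (closedAdj G g s ∧ D g h)
      ≡⟨ sum-cong-≗ (λ g → sum-cong-≗ (λ h → 𝟙-∧ _ (D g h))) ⟩
    ∑[ g < n G ] ∑[ h < n H ] (𝟙 (closedAdj G g s) * 𝟙 (D g h))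
      ≡⟨ sum-cong-≗ (λ g → *-distribˡ-sum (𝟙 (closedAdj G g s)) (𝟙 ∘ D g)) ⟨
    ∑[ g < n G ] (𝟙 (closedAdj G g s) * rowSize g)
      ∎
    where open ≤-Reasoning

  packing*domination≤∣D∣ : ∀ {γH} (S : Subset (n G)) → Is2Packing G S →
                           (∀ E → IsDominating H E → γH ≤ ∣ E ∣) →
                           ∣ S ∣ * γH ≤ ∑[ g < n G ] rowSize g
  packing*domination≤∣D∣ {γH} S packing γH-min = begin
    ∣ S ∣ * γH
      ≡⟨ cong (_* γH) (∣p∣≡∑𝟙 S) ⟩
    (∑[ s < n G ] 𝟙 (lookup S s)) * γH
      ≡⟨ *-distribʳ-sum γH (𝟙 ∘ lookup S) ⟩
    ∑[ s < n G ] (𝟙 (lookup S s) * γH)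
      ≤⟨ ∑-mono-≤ (λ s → *-monoʳ-≤ (𝟙 (lookup S s)) (γH≤∑ s)) ⟩
    ∑[ s < n G ] (𝟙 (lookup S s) * ∑[ g < n G ] (𝟙 (closedAdj G g s) * rowSize g))
      ≡⟨ sum-cong-≗ restrict ⟩
    ∑[ s < n G ] ∑[ g < n G ] (𝟙 (lookup S s ∧ closedAdj G g s) * rowSize g)
      ≤⟨ ∑-disjoint-≤ _ rowSize disjoint ⟩
    ∑[ g < n G ] rowSize g
      ∎
    where
    open ≤-Reasoning

    γH≤∑ : ∀ s → γH ≤ ∑[ g < n G ] (𝟙 (closedAdj G g s) * rowSize g)
    γH≤∑ s = ≤-trans (γH-min (shadow s) (shadow-dominating s)) (∣shadow∣≤ s)

    restrict : ∀ s → 𝟙 (lookup S s) * ∑[ g < n G ] (𝟙 (closedAdj G g s) * rowSize g)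
                   ≡ ∑[ g < n G ] (𝟙 (lookup S s ∧ closedAdj G g s) * rowSize g)
    restrict s = trans (*-distribˡ-sum (𝟙 (lookup S s)) λ g → 𝟙 (closedAdj G g s) * rowSize g)
                       (sum-cong-≗ λ g → trans (sym (*-assoc (𝟙 (lookup S s)) _ (rowSize g)))
                                               (cong (_* rowSize g) (sym (𝟙-∧ (lookup S s) _))))

    disjoint : ∀ g s s' → (lookup S s ∧ closedAdj G g s) ≡ true →
               (lookup S s' ∧ closedAdj G g s') ≡ true → s ≡ s'
    disjoint g s s' s-near s'-near = Is2Packing⇒closedNeighbourhoodsDisjoint G packing g s s'
      (lookup⇒[]= s S (∧-conicalˡ _ _ s-near)) (lookup⇒[]= s' S (∧-conicalˡ _ _ s'-near))
      (∧-conicalʳ _ _ s-near) (∧-conicalʳ _ _ s'-near)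

positive : Fin 3 → Bool
positive Fin.zero    = false
positive (Fin.suc _) = true

𝟙-positive≤toℕ : ∀ x → 𝟙 (positive x) ≤ toℕ x
𝟙-positive≤toℕ Fin.zero    = z≤n
𝟙-positive≤toℕ (Fin.suc _) = s≤s z≤n

module _ (G H : Graph) (f : Fin (n (G ⊠ H)) → Fin 3) where

  support⊠ : Fin (n G) → Fin (n H) → Bool
  support⊠ g h = positive (f (combine g h))

  ∑support⊠≤weight : ∑[ g < n G ] ∑[ h < n H ] 𝟙 (support⊠ g h) ≤ weight f
  ∑support⊠≤weight = begin
    ∑[ g < n G ] ∑[ h < n H ] 𝟙 (support⊠ g h)
      ≤⟨ ∑-mono-≤ {n G} (λ g → ∑-mono-≤ {n H} λ h → 𝟙-positive≤toℕ (f (combine g h))) ⟩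
    ∑[ g < n G ] ∑[ h < n H ] toℕ (f (combine g h))
      ≡⟨ ∑-combine (n G) (n H) (toℕ ∘ f) ⟨
    weight f
      ∎
    where open ≤-Reasoning

  support⊠-dominating : IsRomanDominating (G ⊠ H) f → IsProductDominating G H support⊠
  support⊠-dominating roman g h with f (combine g h) in fgh
  ... | Fin.suc _ = g , h , cong positive fgh , closedAdj-refl G g , closedAdj-refl H h
  ... | Fin.zero with roman (combine g h) fgh
  ...   | u , u~gh , fu≡2 =
    proj₁ (remQuot {n G} (n H) u) , proj₂ (remQuot {n G} (n H) u) ,
    trans (cong (positive ∘ f) (combine-remQuot {n G} (n H) u)) (cong positive fu≡2) ,
    strongAdj'⇒closedAdj G H (subst (λ p → strongAdj' G H (remQuot {n G} (n H) u) p ≡ true)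
                                    (remQuot-combine g h) u~gh)

  packing*domination≤weightˡ : IsRomanDominating (G ⊠ H) f →
                               ∀ {γH} (S : Subset (n G)) → Is2Packing G S →
                               (∀ E → IsDominating H E → γH ≤ ∣ E ∣) → ∣ S ∣ * γH ≤ weight f
  packing*domination≤weightˡ roman S packing γH-min =
    ≤-trans (packing*domination≤∣D∣ G H support⊠ (support⊠-dominating roman) S packing γH-min)
            ∑support⊠≤weight

  packing*domination≤weightʳ : IsRomanDominating (G ⊠ H) f →
                               ∀ {γG} (S : Subset (n H)) → Is2Packing H S →
                               (∀ E → IsDominating G E → γG ≤ ∣ E ∣) → ∣ S ∣ * γG ≤ weight f
  packing*domination≤weightʳ roman S packing γG-min = begin
    ∣ S ∣ * _
      ≤⟨ packing*domination≤∣D∣ H G (flip support⊠) flipped S packing γG-min ⟩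
    ∑[ h < n H ] ∑[ g < n G ] 𝟙 (support⊠ g h)
      ≡⟨ ∑-comm (λ g h → 𝟙 (support⊠ g h)) ⟨
    ∑[ g < n G ] ∑[ h < n H ] 𝟙 (support⊠ g h)
      ≤⟨ ∑support⊠≤weight ⟩
    weight f
      ∎
    where
    open ≤-Reasoning
    flipped : IsProductDominating H G (flip support⊠)
    flipped = IsProductDominating-flip {G} {H} {support⊠} (support⊠-dominating roman)

two-if : Bool → Fin 3
two-if true  = Fin.suc (Fin.suc Fin.zero)
two-if false = Fin.zero

toℕ-two-if-∧ : ∀ a b → toℕ (two-if (a ∧ b)) ≡ 2 * 𝟙 a * 𝟙 b
toℕ-two-if-∧ true  true  = refl
toℕ-two-if-∧ true  false = refl
toℕ-two-if-∧ false b     = refl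

module _ (G H : Graph) (DG : Subset (n G)) (DH : Subset (n H)) where

  twoOn : Fin (n G) → Fin (n H) → Fin 3
  twoOn g h = two-if (lookup DG g ∧ lookup DH h)

  twoOn⊠ : Fin (n (G ⊠ H)) → Fin 3
  twoOn⊠ = lift⊠ G H twoOn

  twoOn⊠-roman : IsDominating G DG → IsDominating H DH →
                 IsRomanDominating (G ⊠ H) twoOn⊠
  twoOn⊠-roman DG-dom DH-dom x x↦0 =
    let g , h = remQuot {n G} (n H) x
        g' , g'∈DG , g'g = IsDominating⇒IsClosedDominating G DG DG-dom g
        h' , h'∈DH , h'h = IsDominating⇒IsClosedDominating H DH DH-dom h
        g'h'↦2 : twoOn g' h' ≡ Fin.suc (Fin.suc Fin.zero)
        g'h'↦2 = cong₂ (λ a b → two-if (a ∧ b)) ([]=⇒lookup g'∈DG) ([]=⇒lookup h'∈DH)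
        distinct : (g' , h') ≢ remQuot {n G} (n H) x
        distinct eq = 0≢1+n (trans (sym x↦0) (trans (cong (uncurry twoOn) (sym eq)) g'h'↦2))
    in combine g' h' ,
       subst (λ p → strongAdj' G H p (remQuot {n G} (n H) x) ≡ true) (sym (remQuot-combine g' h'))
             (closedAdj⇒strongAdj' G H g'g h'h distinct) ,
       trans (lift⊠-combine G H twoOn g' h') g'h'↦2

  weight-twoOn⊠ : weight twoOn⊠ ≡ 2 * ∣ DG ∣ * ∣ DH ∣
  weight-twoOn⊠ = begin
    weight twoOn⊠
      ≡⟨ ∑-combine (n G) (n H) (toℕ ∘ twoOn⊠) ⟩
    ∑[ g < n G ] ∑[ h < n H ] toℕ (twoOn⊠ (combine g h))
      ≡⟨ sum-cong-≗ (λ g → sum-cong-≗ λ h → value g h) ⟩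
    ∑[ g < n G ] ∑[ h < n H ] (2 * 𝟙 (lookup DG g) * 𝟙 (lookup DH h))
      ≡⟨ ∑-product (λ g → 2 * 𝟙 (lookup DG g)) (𝟙 ∘ lookup DH) ⟩
    (∑[ g < n G ] (2 * 𝟙 (lookup DG g))) * ∑[ h < n H ] 𝟙 (lookup DH h)
      ≡⟨ cong (_* _) (*-distribˡ-sum 2 (𝟙 ∘ lookup DG)) ⟨
    2 * (∑[ g < n G ] 𝟙 (lookup DG g)) * ∑[ h < n H ] 𝟙 (lookup DH h)
      ≡⟨ cong₂ (λ a b → 2 * a * b) (∣p∣≡∑𝟙 DG) (∣p∣≡∑𝟙 DH) ⟨
    2 * ∣ DG ∣ * ∣ DH ∣
      ∎
    where
    open ≡-Reasoning
    value : ∀ g h → toℕ (twoOn⊠ (combine g h)) ≡ 2 * 𝟙 (lookup DG g) * 𝟙 (lookup DH h)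
    value g h = trans (cong toℕ (lift⊠-combine G H twoOn g h))
                      (toℕ-two-if-∧ (lookup DG g) (lookup DH h))

corollary22 : (G H : Graph) (γG γH pG pH γR : ℕ) →
    IsDominationNumber G γG → IsDominationNumber H γH →
    IsPackingNumber G pG → IsPackingNumber H pH →
    IsRomanDominationNumber (G ⊠ H) γR →
    ((pG * γH) ⊔ (γG * pH) ≤ γR) × (γR ≤ 2 * γG * γH)
corollary22 G H γG γH pG pH γR
            ((DG , DG-dom , ∣DG∣) , γG-min) ((DH , DH-dom , ∣DH∣) , γH-min)
            ((SG , SG-packing , ∣SG∣) , _) ((SH , SH-packing , ∣SH∣) , _)
            ((f , f-roman , ∣f∣) , γR-min) =
  ⊔-lub lowerG lowerH , upper
  where
  lowerG : pG * γH ≤ γR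
  lowerG = subst₂ _≤_ (cong (_* γH) ∣SG∣) ∣f∣
                   (packing*domination≤weightˡ G H f f-roman SG SG-packing γH-min)

  lowerH : γG * pH ≤ γR
  lowerH = subst₂ _≤_ (trans (cong (_* γG) ∣SH∣) (*-comm pH γG)) ∣f∣
                   (packing*domination≤weightʳ G H f f-roman SH SH-packing γG-min)

  upper : γR ≤ 2 * γG * γH
  upper = subst (γR ≤_)
                (trans (weight-twoOn⊠ G H DG DH) (cong₂ (λ a b → 2 * a * b) ∣DG∣ ∣DH∣))
                (γR-min _ (twoOn⊠-roman G H DG DH DG-dom DH-dom))
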